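{- For every integer $k$, the $k$-element vertex covers and the $k$-element independent sets can each be exactly learned by equivalence queries in $O(n^2)$ rounds. Concretely, for the concept "$V'$ is a vertex cover of $G$ with $|V'|=k$", and likewise for the concept "$V'$ is an independent set of $G$ with $|V'|=k$", there is a learning algorithm making only equivalence queries, with graph hypotheses, that finishes within $O(n^2)$ queries for every graph $G$ on $\{1,\dots,n\}$ and every competent Teacher.
   Context: A vertex set concept is a predicate $\Phi(G,V')$ on finite graphs $G$ and sets $V'\subseteq V(G)$; its solution set is $S(G)=\{V'\subseteq V(G):\Phi(G,V')\}$. Graphs $G,H$ are $\Phi$-equivalent if $V(G)=V(H)$ and $S(G)=S(H)$. A vertex cover of $G$ is a set containing at least one endpoint of every edge. An independent set of $G$ is a set with no two of its vertices adjacent. Learning model (exact learning by equivalence queries): a Teacher privately holds a graph $G$ with vertex set $V=\{1,\dots,n\}$, and the Learner initially knows only $n$. In an equivalence query the Learner presents a hypothesis graph $H$ on $\{1,\dots,n\}$. If $H$ is $\Phi$-equivalent to $G$, the Teacher answers "finished". Otherwise the Teacher returns a counterexample: either a positive counterexample, i.e. a set $V'$ with $\Phi(G,V')$ true and $\Phi(H,V')$ false, or a negative counterexample, i.e. a set $V'$ with $\Phi(H,V')$ true and $\Phi(G,V')$ false. A Teacher is competent if it always answers correctly; it may choose any valid counterexample. A learning algorithm is a Learner strategy that, against every competent Teacher and every $G$, eventually obtains "finished". It runs in $f(n)$ rounds if, for every graph of order $n$ and every competent Teacher, it finishes after at most $f(n)$ queries. -}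

module Defs where

open import Data.Nat using (ℕ; zero; suc; _*_; _≤_)
open import Data.Bool using (Bool; true; false)
open import Data.Fin using (Fin)
open import Data.Fin.Subset using (Subset; _∈_; ∣_∣)
open import Data.List using (List; []; _∷_)
open import Data.List.Relation.Unary.Any using (Any)
open import Data.Product using (_×_; Σ; ∃; proj₂; _,_)
open import Data.Sum using (_⊎_)
open import Relation.Nullary using (¬_)
open import Relation.Binary.PropositionalEquality using (_≡_)
open import Function.Bundles using (_⇔_)

-- Finite simple graphs on the vertex set {1,…,n}, represented as Fin n.

record Graph (n : ℕ) : Set where
  field
    adj    : Fin n → Fin n → Bool
    sym    : ∀ i j → adj i j ≡ adj j i
    irrefl : ∀ i → adj i i ≡ false
open Graph public

Concept : Set₁
Concept = ∀ {n} → Graph n → Subset n → Set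

-- Φ-equivalence: same vertex set (built in) and same solution sets.
Equiv : Concept → ∀ {n} → Graph n → Graph n → Set
Equiv Φ {n} G H = ∀ (V′ : Subset n) → Φ G V′ ⇔ Φ H V′

IsVertexCover : ∀ {n} → Graph n → Subset n → Set
IsVertexCover G V′ = ∀ i j → adj G i j ≡ true → (i ∈ V′ ⊎ j ∈ V′)

IsIndependentSet : ∀ {n} → Graph n → Subset n → Set
IsIndependentSet G V′ = ∀ i j → i ∈ V′ → j ∈ V′ → adj G i j ≡ false

VertexCoverK : ℕ → Concept
VertexCoverK k G V′ = IsVertexCover G V′ × ∣ V′ ∣ ≡ k

IndependentSetK : ℕ → Concept
IndependentSetK k G V′ = IsIndependentSet G V′ × ∣ V′ ∣ ≡ k

data Answer (n : ℕ) : Set where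
  finished : Answer n
  positive : Subset n → Answer n
  negative : Subset n → Answer n

-- History of queries and answers (most recent first).
History : ℕ → Set
History n = List (Graph n × Answer n)

Learner : Set
Learner = (n : ℕ) → History n → Graph n

ValidAnswer : Concept → ∀ {n} → Graph n → Graph n → Answer n → Set
ValidAnswer Φ G H finished     = Equiv Φ G H
ValidAnswer Φ G H (positive V′) = Φ G V′ × ¬ Φ H V′
ValidAnswer Φ G H (negative V′) = Φ H V′ × ¬ Φ G V′

-- A competent Teacher holding G: it may choose any valid answer,
-- adaptively depending on the whole interaction so far.
record Teacher (Φ : Concept) {n : ℕ} (G : Graph n) : Set where
  field
    answer : History n → Graph n → Answer n
    valid  : ∀ h H → ValidAnswer Φ G H (answer h H)
open Teacher public

run : ∀ {Φ : Concept} (L : Learner) {n} {G : Graph n} → Teacher Φ G → ℕ → History n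
run L {n} T zero    = []
run L {n} T (suc m) = (L n (run L T m) , answer T (run L T m) (L n (run L T m))) ∷ run L T m

FinishedWithin : ∀ {n} → History n → Set
FinishedWithin h = Any (λ q → proj₂ q ≡ finished) h

RunsIn : Concept → Learner → (ℕ → ℕ) → Set
RunsIn Φ L f = ∀ (n : ℕ) (G : Graph n) (T : Teacher Φ G) → FinishedWithin (run L T (f n))

IsBigOSquare : (ℕ → ℕ) → Set
IsBigOSquare f = Σ ℕ λ C → Σ ℕ λ N → ∀ n → N ≤ n → f n ≤ C * (n * n)

LearnableInQuadratic : Concept → Set
LearnableInQuadratic Φ = Σ Learner λ L → Σ (ℕ → ℕ) λ f → IsBigOSquare f × RunsIn Φ L f

{-# OPTIONS --safe #-}
module Submission where

-- Both concepts have the form "V′ is admissible and G has no edge among the pairs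
-- forbidden by V′", which is antitone in the edge set of G.  The Learner starts from
-- the complete graph and only ever deletes pairs, so its hypothesis always contains G
-- and no negative counterexample can occur.  A positive counterexample V′ must expose
-- an edge of the hypothesis that V′ forbids; none of the pairs forbidden by V′ is an
-- edge of G, so the Learner deletes them all.  Every round thus discards one of the
-- n² ordered pairs, and "finished" arrives within n² + 1 queries.

open import Defs
open import Data.Bool using (Bool; true; false; not; _∧_)
open import Data.Bool.Properties using (∧-comm; ∧-zeroʳ; ∧-conicalˡ; ∧-conicalʳ; ¬-not; not-¬)
  renaming (_≟_ to _≟ᵇ_)
open import Data.Fin using (Fin; combine; remQuot; _≟_)
open import Data.Fin.Properties using (any?; remQuot-combine)
open import Data.Fin.Subset using (Subset; _∈_; ⊤; _─_; ∣_∣)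
open import Data.Fin.Subset.Properties using (∈⊤; ∣⊤∣≡n; x∈p∩q⁺; x∈p∧x∉q⇒x∈p─q; p∩q≢∅⇒∣p─q∣<∣p∣)
open import Data.List using (foldr)
open import Data.List.Relation.Unary.Any using (here; there)
open import Data.Nat using (ℕ; zero; suc; _+_; _*_; _≤_; _<_)
open import Data.Nat.Properties using (≤-reflexive; ≤-trans; +-comm; +-identityʳ; +-monoʳ-≤; +-monoʳ-<;
  *-mono-≤; <-≤-trans; m≤m+n; 1+n≰n; module ≤-Reasoning)
open import Data.Product using (_×_; _,_; ∃₂; proj₁; proj₂; uncurry)
import Data.Product as Product
open import Data.Product.Function.NonDependent.Propositional using (_×-⇔_)
open import Data.Sum using (_⊎_; inj₁; inj₂)
import Data.Sum as Sum
open import Data.Vec using (lookup; tabulate)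
open import Data.Vec.Properties using (lookup∘tabulate; lookup⇒[]=; []=⇒lookup)
open import Function using (_∘_)
open import Function.Bundles using (_⇔_; mk⇔; Equivalence)
open import Function.Construct.Identity using (⇔-id)
open import Relation.Nullary using (¬_; yes; no; contradiction; does; _×-dec_)
open import Relation.Nullary.Decidable using (dec-true; dec-false; does-⇔)
import Relation.Binary.PropositionalEquality as ≡
open ≡ using (_≡_; _≢_; refl; trans; cong; cong₂)

Avoids : ∀ {n} → Graph n → (Fin n → Fin n → Bool) → Set
Avoids G R = ∀ i j → adj G i j ≡ true → R i j ≡ false

_⊆ᴱ_ : ∀ {n} → Graph n → Graph n → Set
G ⊆ᴱ H = ∀ i j → adj G i j ≡ true → adj H i j ≡ true

avoids-antitone : ∀ {n} {G H : Graph n} {R} → G ⊆ᴱ H → Avoids H R → Avoids G R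
avoids-antitone G⊆H avoids i j e = avoids i j (G⊆H i j e)

¬avoids⇒edge : ∀ {n} {R : Fin n → Fin n → Bool} (G : Graph n) →
               ¬ Avoids G R → ∃₂ λ i j → adj G i j ≡ true × R i j ≡ true
¬avoids⇒edge {R = R} G ¬avoids
  with any? (λ i → any? (λ j → (adj G i j ≟ᵇ true) ×-dec (R i j ≟ᵇ true)))
... | yes edge  = edge
... | no ¬edge = contradiction (λ i j e → ¬-not (λ r → ¬edge (i , j , e , r))) ¬avoids

edge⇒≢ : ∀ {n} (G : Graph n) {i j : Fin n} → adj G i j ≡ true → i ≢ j
edge⇒≢ G {i} e refl = not-¬ (irrefl G i) e

-- Ordered pairs of vertices are encoded in Fin (n * n) by combine, so that a set of
-- pairs is a Subset (n * n) and can be counted with ∣_∣.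

pairSet : ∀ {n} → (Fin n → Fin n → Bool) → Subset (n * n)
pairSet {n} R = tabulate (uncurry R ∘ remQuot n)

lookup-pairSet : ∀ {n} (R : Fin n → Fin n → Bool) i j → lookup (pairSet R) (combine i j) ≡ R i j
lookup-pairSet {n} R i j = trans (lookup∘tabulate (uncurry R ∘ remQuot n) (combine i j))
                                 (cong (uncurry R) (remQuot-combine i j))

∈-pairSet⁺ : ∀ {n} {R : Fin n → Fin n → Bool} {i j} → R i j ≡ true → combine i j ∈ pairSet R
∈-pairSet⁺ {R = R} {i} {j} r = lookup⇒[]= (combine i j) (pairSet R) (trans (lookup-pairSet R i j) r)

∈-pairSet⁻ : ∀ {n} {R : Fin n → Fin n → Bool} {i j} → combine i j ∈ pairSet R → R i j ≡ true
∈-pairSet⁻ {R = R} {i} {j} m = trans (≡.sym (lookup-pairSet R i j)) ([]=⇒lookup m)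

-- Asking for both orientations makes the graph symmetric whatever C is.
core : ∀ {n} → Subset (n * n) → Graph n
core C = record
  { adj    = λ i j → distinct i j ∧ lookup C (combine i j) ∧ lookup C (combine j i)
  ; sym    = λ i j → cong₂ _∧_ (cong not (does-⇔ (mk⇔ ≡.sym ≡.sym) (i ≟ j) (j ≟ i)))
                               (∧-comm (lookup C (combine i j)) (lookup C (combine j i)))
  ; irrefl = λ i → cong (λ b → not b ∧ lookup C (combine i i) ∧ lookup C (combine i i))
                          (dec-true (i ≟ i) refl)
  }
  where
  distinct : Fin _ → Fin _ → Bool
  distinct i j = not (does (i ≟ j))

EdgesIn : ∀ {n} → Graph n → Subset (n * n) → Set
EdgesIn G C = ∀ i j → adj G i j ≡ true → combine i j ∈ C

edgesIn⇒⊆ᴱ-core : ∀ {n} {G : Graph n} {C : Subset (n * n)} → EdgesIn G C → G ⊆ᴱ core C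
edgesIn⇒⊆ᴱ-core {G = G} G⊆C i j e =
  cong₂ _∧_ (cong not (dec-false (i ≟ j) (edge⇒≢ G e)))
            (cong₂ _∧_ ([]=⇒lookup (G⊆C i j e)) ([]=⇒lookup (G⊆C j i (trans (sym G j i) e))))

core-edge⇒∈ : ∀ {n} {C : Subset (n * n)} {i j : Fin n} → adj (core C) i j ≡ true → combine i j ∈ C
core-edge⇒∈ {C = C} {i} {j} e =
  lookup⇒[]= (combine i j) C
    (∧-conicalˡ (lookup C (combine i j)) _ (∧-conicalʳ (not (does (i ≟ j))) _ e))

edgesIn-─ : ∀ {n} {G : Graph n} {C : Subset (n * n)} {R} →
            EdgesIn G C → Avoids G R → EdgesIn G (C ─ pairSet R)
edgesIn-─ {R = R} G⊆C avoids i j e =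
  x∈p∧x∉q⇒x∈p─q (G⊆C i j e) (not-¬ (avoids i j e) ∘ ∈-pairSet⁻ {R = R} {i} {j})

1+n²-isBigOSquare : IsBigOSquare (λ n → suc (n * n))
1+n²-isBigOSquare = 2 , 1 , λ n 1≤n → 1+x≤2*x (*-mono-≤ 1≤n 1≤n)
  where
  open ≤-Reasoning
  1+x≤2*x : ∀ {x} → 1 ≤ x → suc x ≤ 2 * x
  1+x≤2*x {x} 1≤x = begin
    suc x        ≡⟨ +-comm 1 x ⟩
    x + 1        ≤⟨ +-monoʳ-≤ x 1≤x ⟩
    x + x        ≡⟨ cong (x +_) (+-identityʳ x) ⟨
    2 * x        ∎

record ForbiddenPairPresentation (Φ : Concept) : Set₁ where
  field
    Admissible       : ∀ {n} → Subset n → Set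
    forbidden        : ∀ {n} → Subset n → Fin n → Fin n → Bool
    characterisation : ∀ {n} (G : Graph n) (V′ : Subset n) →
                       Φ G V′ ⇔ (Avoids G (forbidden V′) × Admissible V′)

module ForbiddenPairLearner {Φ : Concept} (P : ForbiddenPairPresentation Φ) where
  open ForbiddenPairPresentation P
  open Equivalence using (to; from)

  antitone : ∀ {n} {G H : Graph n} {V′} → G ⊆ᴱ H → Φ H V′ → Φ G V′
  antitone {G = G} {H} {V′} G⊆H =
    from (characterisation G V′)
    ∘ Product.map₁ (avoids-antitone {G = G} {H} {forbidden V′} G⊆H)
    ∘ to (characterisation H V′)

  forbidden-edge : ∀ {n} {G H : Graph n} {V′} → Φ G V′ → ¬ Φ H V′ →
                   ∃₂ λ i j → adj H i j ≡ true × forbidden V′ i j ≡ true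
  forbidden-edge {G = G} {H = H} ΦG ¬ΦH = ¬avoids⇒edge H λ avoids →
    ¬ΦH (from (characterisation H _) (avoids , proj₂ (to (characterisation G _) ΦG)))

  prune : ∀ {n} → Answer n → Subset (n * n) → Subset (n * n)
  prune finished       C = C
  prune (positive V′)  C = C ─ pairSet (forbidden V′)
  prune (negative _)   C = C

  candidates : ∀ {n} → History n → Subset (n * n)
  candidates = foldr (prune ∘ proj₂) ⊤

  learner : Learner
  learner n h = core (candidates h)

  answer-progress : ∀ {n} {G : Graph n} {C : Subset (n * n)} →
                    EdgesIn G C → ∀ {a} → ValidAnswer Φ G (core C) a →
                    a ≡ finished ⊎ (EdgesIn G (prune a C) × ∣ prune a C ∣ < ∣ C ∣)
  answer-progress G⊆C {finished} _ = inj₁ refl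
  answer-progress {G = G} {C} G⊆C {negative V′} (ΦH , ¬ΦG) =
    contradiction (antitone (edgesIn⇒⊆ᴱ-core {G = G} {C} G⊆C) ΦH) ¬ΦG
  answer-progress {G = G} {C = C} G⊆C {positive V′} (ΦG , ¬ΦH)
    with i , j , e , r ← forbidden-edge ΦG ¬ΦH =
    inj₂ ( edgesIn-─ {G = G} {C} {forbidden V′} G⊆C (proj₁ (to (characterisation G V′) ΦG))
         , p∩q≢∅⇒∣p─q∣<∣p∣ C (pairSet (forbidden V′))
             (combine i j , x∈p∩q⁺ ( core-edge⇒∈ {C = C} {i} {j} e
                                   , ∈-pairSet⁺ {R = forbidden V′} r)))

  module _ {n} {G : Graph n} (T : Teacher Φ G) where

    history : ℕ → History n
    history = run learner T

    progress : ∀ m → FinishedWithin (history m)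
                   ⊎ (EdgesIn G (candidates (history m)) × m + ∣ candidates (history m) ∣ ≤ n * n)
    progress zero = inj₂ ((λ _ _ _ → ∈⊤) , ≤-reflexive (∣⊤∣≡n (n * n)))
    progress (suc m) with progress m
    ... | inj₁ done = inj₁ (there done)
    ... | inj₂ (G⊆C , bound) =
      Sum.map here (Product.map₂ λ shrinks → <-≤-trans (+-monoʳ-< m shrinks) bound)
              (answer-progress G⊆C (valid T (history m) (learner n (history m))))

    finishes : FinishedWithin (history (suc (n * n)))
    finishes with progress (suc (n * n))
    ... | inj₁ done       = done
    ... | inj₂ (_ , bound) = contradiction (≤-trans (m≤m+n (suc (n * n)) _) bound) 1+n≰n

  learnableInQuadratic : LearnableInQuadratic Φ
  learnableInQuadratic = learner , (λ n → suc (n * n)) , 1+n²-isBigOSquare , λ n G → finishes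

bothOutside : ∀ {n} → Subset n → Fin n → Fin n → Bool
bothOutside V′ i j = not (lookup V′ i) ∧ not (lookup V′ j)

bothInside : ∀ {n} → Subset n → Fin n → Fin n → Bool
bothInside V′ i j = lookup V′ i ∧ lookup V′ j

not∧not≡false⇒⊎ : ∀ x y → not x ∧ not y ≡ false → x ≡ true ⊎ y ≡ true
not∧not≡false⇒⊎ true  _    _ = inj₁ refl
not∧not≡false⇒⊎ false true _ = inj₂ refl

⊎⇒not∧not≡false : ∀ {x y} → x ≡ true ⊎ y ≡ true → not x ∧ not y ≡ false
⊎⇒not∧not≡false     (inj₁ refl) = refl
⊎⇒not∧not≡false {x} (inj₂ refl) = ∧-zeroʳ (not x)

isVertexCover⇔avoids : ∀ {n} (G : Graph n) V′ → IsVertexCover G V′ ⇔ Avoids G (bothOutside V′)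
isVertexCover⇔avoids G V′ = mk⇔
  (λ covers i j e → ⊎⇒not∧not≡false (Sum.map []=⇒lookup []=⇒lookup (covers i j e)))
  (λ avoids i j e → Sum.map (lookup⇒[]= i V′) (lookup⇒[]= j V′) (not∧not≡false⇒⊎ _ _ (avoids i j e)))

isIndependentSet⇔avoids : ∀ {n} (G : Graph n) V′ → IsIndependentSet G V′ ⇔ Avoids G (bothInside V′)
isIndependentSet⇔avoids G V′ = mk⇔
  (λ independent i j e → ¬-not λ both →
     not-¬ (independent i j (lookup⇒[]= i V′ (∧-conicalˡ _ _ both))
                            (lookup⇒[]= j V′ (∧-conicalʳ _ _ both))) e)
  (λ avoids i j i∈V′ j∈V′ → ¬-not λ e →
     not-¬ (avoids i j e) (cong₂ _∧_ ([]=⇒lookup i∈V′) ([]=⇒lookup j∈V′)))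

vertexCoverK-presentation : ∀ k → ForbiddenPairPresentation (VertexCoverK k)
vertexCoverK-presentation k = record
  { Admissible       = λ V′ → ∣ V′ ∣ ≡ k
  ; forbidden        = bothOutside
  ; characterisation = λ G V′ → isVertexCover⇔avoids G V′ ×-⇔ ⇔-id _
  }

independentSetK-presentation : ∀ k → ForbiddenPairPresentation (IndependentSetK k)
independentSetK-presentation k = record
  { Admissible       = λ V′ → ∣ V′ ∣ ≡ k
  ; forbidden        = bothInside
  ; characterisation = λ G V′ → isIndependentSet⇔avoids G V′ ×-⇔ ⇔-id _
  }

mainTheorem5 : (k : ℕ) → LearnableInQuadratic (VertexCoverK k) × LearnableInQuadratic (IndependentSetK k)
mainTheorem5 k = ForbiddenPairLearner.learnableInQuadratic (vertexCoverK-presentation k)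
               , ForbiddenPairLearner.learnableInQuadratic (independentSetK-presentation k)
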